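{- Let $S=\lambda\sqcup\nu$ be a splice of a set partition $\lambda$ of $[n]$, and let $R$ be a row of $S$. Let $I$ be the connected component of the graph of $\lambda$ containing $\{i:(i,k)\in R\}$ and $K$ the connected component containing $\{k:(i,k)\in R\}$. Then $I\neq K$. Moreover, if $\lambda$ is nonnesting, then every $(i,k)\in\nu$ with $i\in I$ or $k\in K$ belongs to $R$.
   Context: $[[n]]=\{(i,j):1\le i<j\le n\}$; $(i,j)\preceq(r,s)$ iff $r\le i<j\le s$. A set partition of $[n]$ is $\lambda\subseteq[[n]]$ with no two distinct elements sharing a first or sharing a second coordinate; its graph is the graph on vertex set $[n]$ with edge set $\lambda$. It is nonnesting if no two distinct elements are $\preceq$-comparable. For disjoint set partitions $\lambda,\nu$, $S=\lambda\sqcup\nu$ is a splice of $\lambda$ if (S1) for every $(i,k)\in\nu$ there is $j$, $i<j<k$, with $(i,j)\in\lambda$ or $(j,k)\in\lambda$; (S2) for all $1\le j<k\le n$: there is $i$ with $(i,j)\in\lambda,(i,k)\in\nu$ iff there is $l$ with $(k,l)\in\lambda,(j,l)\in\nu$. $\mathrm{bind}(S)=\{(i,j,k,l):(i,j),(k,l)\in\lambda,(i,k),(j,l)\in\nu,j<k\}$. The rows of $S$ are the equivalence classes of $\nu$ under the equivalence relation generated by $(i,k)\sim(j,l)$ whenever $(i,j,k,l)\in\mathrm{bind}(S)$. -}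

module Defs where

open import Data.Nat using (ℕ; _≤_; _<_)
open import Data.Product using (Σ; ∃; ∃-syntax; _×_; _,_)
open import Data.Sum using (_⊎_)
open import Data.Empty using (⊥)
open import Relation.Nullary using (¬_)
open import Relation.Binary.PropositionalEquality using (_≡_)
open import Relation.Binary.Construct.Closure.Equivalence using (EqClosure)

Pairs : Set₁
Pairs = ℕ → ℕ → Set

InRange : ℕ → ℕ → ℕ → Set
InRange n i j = (1 ≤ i) × (i < j) × (j ≤ n)

IsSetPartition : ℕ → Pairs → Set
IsSetPartition n L =
  (∀ i j → L i j → InRange n i j) ×
  (∀ i j j' → L i j → L i j' → j ≡ j') ×
  (∀ i i' j → L i j → L i' j → i ≡ i')

Nonnesting : Pairs → Set
Nonnesting L = ∀ i j r s → L i j → L r s → ¬ ((i , j) ≡ (r , s)) → ¬ ((r ≤ i) × (j ≤ s))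

Disjoint : Pairs → Pairs → Set
Disjoint L N = ∀ i j → L i j → N i j → ⊥

IsSplice : ℕ → Pairs → Pairs → Set
IsSplice n L N =
  IsSetPartition n L × IsSetPartition n N × Disjoint L N ×
  (∀ i k → N i k → ∃[ j ] ((i < j) × (j < k) × (L i j ⊎ L j k))) ×
  (∀ j k → 1 ≤ j → j < k → k ≤ n →
     ((∃[ i ] (L i j × N i k)) → (∃[ l ] (L k l × N j l))) ×
     ((∃[ l ] (L k l × N j l)) → (∃[ i ] (L i j × N i k))))

Bind : Pairs → Pairs → ℕ → ℕ → ℕ → ℕ → Set
Bind L N i j k l = L i j × L k l × N i k × N j l × (j < k)

BindRel : Pairs → Pairs → ℕ × ℕ → ℕ × ℕ → Set
BindRel L N (i , k) (j , l) = Bind L N i j k l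

Row : Pairs → Pairs → ℕ → ℕ → Pairs
Row L N a b i k = N i k × EqClosure (BindRel L N) (a , b) (i , k)

Connected : Pairs → ℕ → ℕ → Set
Connected L = EqClosure L

-- The graph of a set partition λ is a disjoint union of increasing chains, so two vertices
-- are connected exactly when one reaches the other along λ. A bind step moves both ends of
-- a ν-arc one λ-edge forward, hence the first (second) coordinates of a row stay in one
-- component. If (x,y) ∈ ν had x, y in one chain x → x' → ⋯ → y, then x' < y and (S2) yields
-- (x',l) ∈ ν with (y,l) ∈ λ, so x' and l lie in one chain again; the source strictly
-- increases and is bounded by n, so this is impossible. For nonnesting λ, (S1) forces
-- every λ-successor of the source of a ν-arc to precede its target (and dually), so a ν-arc
-- can be walked along the whole chain of its source or target by bind steps.
module Submission where

open import Defs
open import Data.Nat using (ℕ; zero; suc; _≤_; _<_; _+_)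
open import Data.Nat.Properties
  using (≤-refl; ≤-trans; <⇒≤; <⇒≢; ≤⇒≯; <-irrefl; <-cmp; +-monoʳ-<; m≤m+n)
open import Data.Product using (∃-syntax; _×_; _,_; proj₁; proj₂)
open import Data.Sum using (_⊎_; inj₁; inj₂)
open import Data.Empty using (⊥; ⊥-elim)
open import Function using (id; flip)
open import Relation.Nullary using (¬_)
open import Relation.Binary.PropositionalEquality using (_≡_; refl; sym; cong)
open import Relation.Binary.Definitions using (tri<; tri≈; tri>)
open import Relation.Binary.Construct.Closure.ReflexiveTransitive
  using (Star; ε; _◅_; _◅◅_; fold; reverse)
open import Relation.Binary.Construct.Closure.Symmetric using (fwd; bwd)
open import Relation.Binary.Construct.Closure.Equivalence as EqClosure using (EqClosure)

module SetPartition {n : ℕ} {L : Pairs} (partition : IsSetPartition n L) where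

  range : ∀ {i j} → L i j → InRange n i j
  range = proj₁ partition _ _

  positive : ∀ {i j} → L i j → 1 ≤ i
  positive e = proj₁ (range e)

  increasing : ∀ {i j} → L i j → i < j
  increasing e = proj₁ (proj₂ (range e))

  bounded : ∀ {i j} → L i j → j ≤ n
  bounded e = proj₂ (proj₂ (range e))

  functional : ∀ {i j j'} → L i j → L i j' → j ≡ j'
  functional = proj₁ (proj₂ partition) _ _ _

  injective : ∀ {i i' j} → L i j → L i' j → i ≡ i'
  injective = proj₂ (proj₂ partition) _ _ _

  reachable⇒≤ : ∀ {x y} → Star L x y → x ≤ y
  reachable⇒≤ = fold _≤_ (λ e → ≤-trans (<⇒≤ (increasing e))) ≤-refl

  connected⇒chain : ∀ {x y} → Connected L x y → Star L x y ⊎ Star (flip L) x y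
  connected⇒chain ε = inj₁ ε
  connected⇒chain (fwd e ◅ c) with connected⇒chain c
  ... | inj₁ p = inj₁ (e ◅ p)
  ... | inj₂ ε = inj₁ (e ◅ ε)
  ... | inj₂ (e' ◅ p) with injective e e'
  ...   | refl = inj₂ p
  connected⇒chain (bwd e ◅ c) with connected⇒chain c
  ... | inj₂ p = inj₂ (e ◅ p)
  ... | inj₁ ε = inj₂ (e ◅ ε)
  ... | inj₁ (e' ◅ p) with functional e e'
  ...   | refl = inj₁ p

  connected⇒reachable : ∀ {x y} → Connected L x y → Star L x y ⊎ Star L y x
  connected⇒reachable c with connected⇒chain c
  ... | inj₁ p = inj₁ p
  ... | inj₂ p = inj₂ (reverse id p)

module Splice {n : ℕ} {L N : Pairs} (splice : IsSplice n L N) where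

  module L-part = SetPartition (proj₁ splice)
  module N-part = SetPartition (proj₁ (proj₂ splice))

  disjoint : Disjoint L N
  disjoint = proj₁ (proj₂ (proj₂ splice))

  S1 : ∀ i k → N i k → ∃[ j ] ((i < j) × (j < k) × (L i j ⊎ L j k))
  S1 = proj₁ (proj₂ (proj₂ (proj₂ splice)))

  S2 : ∀ j k → 1 ≤ j → j < k → k ≤ n →
       ((∃[ i ] (L i j × N i k)) → (∃[ l ] (L k l × N j l))) ×
       ((∃[ l ] (L k l × N j l)) → (∃[ i ] (L i j × N i k)))
  S2 = proj₂ (proj₂ (proj₂ (proj₂ splice)))

  SameRow : ℕ × ℕ → ℕ × ℕ → Set
  SameRow = EqClosure (BindRel L N)

  sameRow⇒connected : ∀ {p q} → SameRow p q →
    Connected L (proj₁ p) (proj₁ q) × Connected L (proj₂ p) (proj₂ q)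
  sameRow⇒connected r =
    EqClosure.gmap proj₁ (λ (lij , _) → lij) r , EqClosure.gmap proj₂ (λ (_ , lkl , _) → lkl) r

  bind-forward : ∀ {x x' y} → N x y → L x x' → x' < y → ∃[ l ] Bind L N x x' y l
  bind-forward {x} {x'} {y} nxy lxx' x'<y =
    let (l , lyl , nx'l) = proj₁ (S2 x' y 1≤x' x'<y (N-part.bounded nxy)) (x , lxx' , nxy)
    in l , lxx' , lyl , nxy , nx'l , x'<y
    where
    1≤x' : 1 ≤ x'
    1≤x' = ≤-trans (L-part.positive lxx') (<⇒≤ (L-part.increasing lxx'))

  bind-backward : ∀ {c' y y'} → N c' y' → L y y' → c' < y → ∃[ w ] Bind L N w c' y y'
  bind-backward {c'} {y} {y'} nc'y' lyy' c'<y =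
    let (w , lwc' , nwy) = proj₂ (S2 c' y (N-part.positive nc'y') c'<y y≤n) (y' , lyy' , nc'y')
    in w , lwc' , lyy' , nwy , nc'y' , c'<y
    where
    y≤n : y ≤ n
    y≤n = ≤-trans (<⇒≤ (L-part.increasing lyy')) (L-part.bounded lyy')

  -- fuel bounds how often the source x can still increase before it would exceed n
  ν-arc-not-along-chain : ∀ fuel {x y} → n ≤ fuel + x → N x y → Star L x y → ⊥
  ν-arc-not-along-chain _ _ nxy ε = <-irrefl refl (N-part.increasing nxy)
  ν-arc-not-along-chain zero n≤x nxy (_ ◅ _) =
    ≤⇒≯ (≤-trans (N-part.bounded nxy) n≤x) (N-part.increasing nxy)
  ν-arc-not-along-chain (suc fuel) {x} {y} n≤fuel+x nxy (_◅_ {j = x'} lxx' p) with <-cmp x' y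
  ... | tri≈ _ refl _ = disjoint x y lxx' nxy
  ... | tri> _ _ y<x' = ≤⇒≯ (L-part.reachable⇒≤ p) y<x'
  ... | tri< x'<y _ _ =
    let (_ , _ , lyl , _ , nx'l , _) = bind-forward nxy lxx' x'<y
        n≤fuel+x' = ≤-trans n≤fuel+x (+-monoʳ-< fuel (L-part.increasing lxx'))
    in ν-arc-not-along-chain fuel n≤fuel+x' nx'l (p ◅◅ lyl ◅ ε)

  ν-arc-disconnected : ∀ {x y} → N x y → ¬ Connected L x y
  ν-arc-disconnected {x} nxy c with L-part.connected⇒reachable c
  ... | inj₁ p = ν-arc-not-along-chain n (m≤m+n n x) nxy p
  ... | inj₂ p = ≤⇒≯ (L-part.reachable⇒≤ p) (N-part.increasing nxy)

  module NonnestingSplice (nonnesting : Nonnesting L) where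

    -- (S1) puts a λ-arc inside (x,y) at x or at y; the one at y would be nested in (x,x').
    successor<target : ∀ {x x' y} → N x y → L x x' → x' < y
    successor<target {x} {x'} {y} nxy lxx' with S1 x y nxy
    ... | j , _ , j<y , inj₁ lxj with L-part.functional lxj lxx'
    ...   | refl = j<y
    successor<target {x} {x'} {y} nxy lxx' | j , x<j , _ , inj₂ ljy with <-cmp x' y
    ...   | tri< x'<y _ _ = x'<y
    ...   | tri≈ _ refl _ = ⊥-elim (disjoint x y lxx' nxy)
    ...   | tri> _ _ y<x' =
      ⊥-elim (nonnesting j y x x' ljy lxx' (λ eq → <⇒≢ x<j (sym (cong proj₁ eq))) (<⇒≤ x<j , <⇒≤ y<x'))

    source<predecessor : ∀ {x y y'} → N x y' → L y y' → x < y
    source<predecessor {x} {y} {y'} nxy' lyy' with S1 x y' nxy'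
    ... | j , x<j , _ , inj₂ ljy' with L-part.injective ljy' lyy'
    ...   | refl = x<j
    source<predecessor {x} {y} {y'} nxy' lyy' | j , _ , j<y' , inj₁ lxj with <-cmp x y
    ...   | tri< x<y _ _ = x<y
    ...   | tri≈ _ refl _ = ⊥-elim (disjoint x y' lyy' nxy')
    ...   | tri> _ _ y<x =
      ⊥-elim (nonnesting x j y y' lxj lyy' (λ eq → <⇒≢ y<x (sym (cong proj₁ eq))) (<⇒≤ y<x , <⇒≤ j<y'))

    walk-source : ∀ {c i d} → Star L c i → N c d → ∃[ d' ] (N i d' × SameRow (c , d) (i , d'))
    walk-source ε ncd = _ , ncd , ε
    walk-source (lcc' ◅ p) ncd =
      let (_ , bind) = bind-forward ncd lcc' (successor<target ncd lcc')
          (_ , _ , _ , nc'l , _) = bind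
          (d' , nid' , r) = walk-source p nc'l
      in d' , nid' , fwd bind ◅ r

    walk-target : ∀ {d k i} → Star L d k → N i k → ∃[ c ] (N c d × SameRow (c , d) (i , k))
    walk-target ε nik = _ , nik , ε
    walk-target (ldd' ◅ p) nik =
      let (c' , nc'd' , r) = walk-target p nik
          (w , bind) = bind-backward nc'd' ldd' (source<predecessor nc'd' ldd')
          (_ , _ , nwd , _) = bind
      in w , nwd , fwd bind ◅ r

    sameRow-by-source : ∀ {c d i k} → Connected L c i → N c d → N i k → SameRow (i , k) (c , d)
    sameRow-by-source c~i ncd nik with L-part.connected⇒reachable c~i
    ... | inj₁ p with walk-source p ncd
    ...   | _ , nid' , r with N-part.functional nik nid'
    ...     | refl = EqClosure.symmetric _ r
    sameRow-by-source c~i ncd nik | inj₂ p with walk-source p nik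
    ...   | _ , ncd' , r with N-part.functional ncd ncd'
    ...     | refl = r

    sameRow-by-target : ∀ {c d i k} → Connected L d k → N c d → N i k → SameRow (i , k) (c , d)
    sameRow-by-target d~k ncd nik with L-part.connected⇒reachable d~k
    ... | inj₁ p with walk-target p nik
    ...   | _ , nc'd , r with N-part.injective ncd nc'd
    ...     | refl = EqClosure.symmetric _ r
    sameRow-by-target d~k ncd nik | inj₂ p with walk-target p ncd
    ...   | _ , nc'k , r with N-part.injective nik nc'k
    ...     | refl = r

lemma3p2 : (n : ℕ) (L N : Pairs) → IsSplice n L N →
    (a b : ℕ) → N a b →
    ((∀ i k i' k' → Row L N a b i k → Row L N a b i' k' → Connected L i i' × Connected L k k') ×
     (∀ i k i' k' → Row L N a b i k → Row L N a b i' k' → ¬ Connected L i k')) ×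
    (Nonnesting L → ∀ c d → N c d →
      ((∃[ i ] ∃[ k ] (Row L N a b i k × Connected L c i)) ⊎
       (∃[ i ] ∃[ k ] (Row L N a b i k × Connected L d k))) →
      Row L N a b c d)
lemma3p2 n L N splice a b _ =
  ( (λ _ _ _ _ (_ , r) (_ , r') → sameRow⇒connected (EqClosure.symmetric _ r ◅◅ r'))
  , (λ _ _ _ _ (_ , r) (nik' , r') c →
       ν-arc-disconnected nik' (proj₁ (sameRow⇒connected (EqClosure.symmetric _ r' ◅◅ r)) ◅◅ c)))
  , λ { nonnesting _ _ ncd (inj₁ (_ , _ , (nik , r) , c~i)) →
          ncd , r ◅◅ NonnestingSplice.sameRow-by-source nonnesting c~i ncd nik
        ; nonnesting _ _ ncd (inj₂ (_ , _ , (nik , r) , d~k)) →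
          ncd , r ◅◅ NonnestingSplice.sameRow-by-target nonnesting d~k ncd nik }
  where open Splice splice
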